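{- Let $M$ be a matroid on $[n]$, $I\subseteq[n]$, and $w\in\mathbb{R}^n$ with pairwise distinct coordinates. (a) If some $i\in I$ is a loop of $M$, then $\Delta_w(M,I)=\emptyset$. (b) If $i\in I$ is a coloop of $M$, then $\Delta_w(M,I)=\mathrm{cone}(\Delta_w(M/i,I\setminus i),i)$. (c) If $i=\max(I)$ (in the order induced by $w$) is neither a loop nor a coloop of $M$, then $\Delta_w(M,I)=\Delta_w(M\setminus i,I\setminus i)\cup\mathrm{cone}(\Delta_w(M/i,I\setminus i),i)$.
   Context: $w$ orders $[n]$ by $i<j$ iff $w_i<w_j$ (and restricts to an order on any subset). For a circuit $C$ of $M$, the $I$-broken circuit is $b_I(C)=C\setminus\min(C)$ if $C\subseteq I$, and $b_I(C)=(C\cap I)\cup\{\max(C\setminus I)\}$ if $C\not\subseteq I$. $\Delta_w(M,I)$ is the collection of all $\tau\subseteq[n]$ (ground set of $M$) containing no $I$-broken circuit of $M$; for $M\setminus i$ and $M/i$ the ground set is $[n]\setminus\{i\}$ with the restricted order. $M\setminus i$ and $M/i$ denote deletion and contraction. For a simplicial complex $\Delta$ on $[n]\setminus\{i\}$, $\mathrm{cone}(\Delta,i)=\Delta\cup\{S\cup\{i\}:S\in\Delta\}$.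
   Formalization: The weight vector w has rational coordinates instead of real ones. -}

module Defs where

open import Data.Nat using (ℕ; _<_)
open import Data.Fin using (Fin)
open import Data.Fin.Subset using (Subset; _∈_; _∉_; _⊆_; _∪_; _∩_; _─_; _-_; ⁅_⁆; ∣_∣; ⊤; ⊥)
open import Data.Rational as ℚ using (ℚ)
open import Data.Product using (Σ; _×_; ∃; ∃-syntax)
open import Data.Sum using (_⊎_)
open import Relation.Nullary using (¬_)
open import Relation.Binary.PropositionalEquality using (_≡_; _≢_)
open import Level using (0ℓ) renaming (suc to lsuc)

record MatroidData (n : ℕ) : Set₁ where
  field
    E     : Subset n
    Indep : Subset n → Set

open MatroidData public

record IsMatroid {n : ℕ} (M : MatroidData n) : Set where
  field
    indep-⊆E  : ∀ X → Indep M X → X ⊆ E M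
    indep-∅   : Indep M ⊥
    indep-↓   : ∀ X Y → Y ⊆ X → Indep M X → Indep M Y
    indep-aug : ∀ X Y → Indep M X → Indep M Y → ∣ X ∣ < ∣ Y ∣ →
                ∃[ y ] (y ∈ Y × y ∉ X × Indep M (X ∪ ⁅ y ⁆))

module _ {n : ℕ} (M : MatroidData n) where

  Dependent : Subset n → Set
  Dependent X = X ⊆ E M × ¬ Indep M X

  Circuit : Subset n → Set
  Circuit C = Dependent C × (∀ D → D ⊆ C → D ≢ C → Indep M D)

  Basis : Subset n → Set
  Basis B = Indep M B × (∀ X → Indep M X → B ⊆ X → X ≡ B)

  Loop : Fin n → Set
  Loop i = i ∈ E M × ¬ Indep M ⁅ i ⁆

  Coloop : Fin n → Set
  Coloop i = i ∈ E M × (∀ B → Basis B → i ∈ B)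

  deletion : Fin n → MatroidData n
  deletion i = record
    { E     = E M - i
    ; Indep = λ X → i ∉ X × Indep M X }

  -- contraction M / i : ground set E ∖ {i};
  -- if i is a loop, M / i = M \ i; otherwise X is independent iff X ∪ {i} is.
  contraction : Fin n → MatroidData n
  contraction i = record
    { E     = E M - i
    ; Indep = λ X → i ∉ X × (Loop i → Indep M X) × (¬ Loop i → Indep M (X ∪ ⁅ i ⁆)) }

_∖_ : {n : ℕ} → MatroidData n → Fin n → MatroidData n
M ∖ i = deletion M i

_/_ : {n : ℕ} → MatroidData n → Fin n → MatroidData n
M / i = contraction M i

module _ {n : ℕ} (w : Fin n → ℚ) where

  IsMin : Subset n → Fin n → Set
  IsMin S m = m ∈ S × (∀ x → x ∈ S → w m ℚ.≤ w x)

  IsMax : Subset n → Fin n → Set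
  IsMax S m = m ∈ S × (∀ x → x ∈ S → w x ℚ.≤ w m)

  BrokenOf : Subset n → Subset n → Subset n → Set
  BrokenOf I C B =
      (C ⊆ I × Σ (Fin n) λ m → IsMin C m × B ≡ C - m)
    ⊎ (¬ (C ⊆ I) × Σ (Fin n) λ m → IsMax (C ─ I) m × B ≡ (C ∩ I) ∪ ⁅ m ⁆)

  Δ : MatroidData n → Subset n → Subset n → Set
  Δ M I τ = τ ⊆ E M × (∀ C B → Circuit M C → BrokenOf I C B → ¬ (B ⊆ τ))

cone : {n : ℕ} → (Subset n → Set) → Fin n → Subset n → Set
cone Δ' i τ = Δ' τ ⊎ Σ (Subset _) λ S → Δ' S × τ ≡ S ∪ ⁅ i ⁆

-- The three parts rest on how circuits of M, M ∖ i and M / i correspond. A loop i ∈ I is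
-- the circuit {i}, whose I-broken circuit is empty. The circuits of M ∖ i are the circuits
-- of M avoiding i. A circuit C of M / i is, itself or with i added, a circuit of M; a circuit
-- of M through i becomes a circuit of M / i on removing i; and a circuit of M avoiding i is a
-- union of circuits of M / i. Broken circuits follow these correspondences up to adding or
-- removing i, provided i is the largest element of I whenever it lies on a circuit: this is
-- automatic for a coloop, which lies on no circuit, and is the hypothesis of part (c).
module Submission where

open import Defs
open import Data.Rational using (ℚ) renaming (_≤_ to _≤ℚ_)
import Data.Rational.Properties as ℚ
open import Data.Nat using (ℕ; zero; suc; _≤_; _≤?_)
open import Data.Nat.Properties using (≰⇒>; ≤-<-trans)
open import Data.Fin using (Fin; _≟_)
open import Data.Fin.Properties using (any?)
open import Data.Fin.Subset
  using (Subset; inside; outside; _∈_; _∉_; _⊆_; _⊂_; _⊃_; _∪_; _∩_; _─_; _-_; ⁅_⁆; ∣_∣; ⊤; ⊥)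
open import Data.Fin.Subset.Properties
open import Data.Fin.Subset.Induction using (⊂-wellFounded; ⊃-wellFounded; Acc; acc)
open import Data.Vec using ([]; _∷_; here; there)
open import Data.Product using (Σ-syntax; ∃-syntax; _×_; _,_; proj₁; proj₂)
open import Data.Sum using (_⊎_; inj₁; inj₂; [_,_])
import Data.Sum as Sum
open import Data.Empty using (⊥-elim)
open import Function using (_∘_; case_of_)
open import Function.Bundles using (_⇔_; mk⇔; Equivalence)
open import Function.Properties.Equivalence using () renaming (sym to ⇔-sym)
open import Relation.Nullary using (¬_; Dec; yes; no)
open import Relation.Nullary.Decidable
  using (_×-dec_; ¬?; decidable-stable; ¬¬-excluded-middle)
import Relation.Nullary.Decidable as Dec
open import Relation.Nullary.Negation using (¬¬-map)
open import Relation.Binary.PropositionalEquality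
  using (_≡_; _≢_; refl; sym; trans; subst; cong)

private
  variable
    n : ℕ
    x y : Fin n
    p q r : Subset n

x∈p─q⇒x∉q : ∀ (p q : Subset n) → x ∈ p ─ q → x ∉ q
x∈p─q⇒x∉q (_ ∷ p) (inside ∷ q)  (there x∈p─q) (there x∈q) = x∈p─q⇒x∉q p q x∈p─q x∈q
x∈p─q⇒x∉q (_ ∷ p) (outside ∷ q) (there x∈p─q) (there x∈q) = x∈p─q⇒x∉q p q x∈p─q x∈q
x∈p─q⇒x∉q (inside ∷ p) (outside ∷ q) here ()

x∈p─q⁻ : ∀ (p q : Subset n) → x ∈ p ─ q → x ∈ p × x ∉ q
x∈p─q⁻ p q x∈p─q = p─q⊆p p q x∈p─q , x∈p─q⇒x∉q p q x∈p─q

x∈p-y⁻ : x ∈ p - y → x ∈ p × x ≢ y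
x∈p-y⁻ {p = p} {y = y} x∈p-y =
  p─q⊆p p ⁅ y ⁆ x∈p-y , x∉⁅y⁆⇒x≢y (x∈p─q⇒x∉q p ⁅ y ⁆ x∈p-y)

x∈p⇔x∈p-y : x ≢ y → x ∈ p ⇔ x ∈ p - y
x∈p⇔x∈p-y {y = y} {p = p} x≢y =
  mk⇔ (λ x∈p → x∈p∧x≢y⇒x∈p-y x∈p x≢y) (p─q⊆p p ⁅ y ⁆)

y∉p-y : ∀ p (y : Fin n) → y ∉ p - y
y∉p-y p y y∈p-y = proj₂ (x∈p-y⁻ y∈p-y) refl

p⊆q-y⇒y∉p : p ⊆ q - y → y ∉ p
p⊆q-y⇒y∉p {q = q} {y = y} p⊆q-y = y∉p-y q y ∘ p⊆q-y

x∈p∪⁅y⁆⁻ : x ∈ p ∪ ⁅ y ⁆ → x ∈ p ⊎ x ≡ y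
x∈p∪⁅y⁆⁻ {p = p} {y = y} x∈ = Sum.map₂ (x∈⁅y⁆⇒x≡y y) (x∈p∪q⁻ p ⁅ y ⁆ x∈)

y∈p∪⁅y⁆ : ∀ p (y : Fin n) → y ∈ p ∪ ⁅ y ⁆
y∈p∪⁅y⁆ p y = q⊆p∪q p ⁅ y ⁆ (x∈⁅x⁆ y)

y∈p⇒⁅y⁆⊆p : y ∈ p → ⁅ y ⁆ ⊆ p
y∈p⇒⁅y⁆⊆p {y = y} y∈p x∈⁅y⁆ with x∈⁅y⁆⇒x≡y y x∈⁅y⁆
... | refl = y∈p

p∪⁅y⁆⊆ : p ⊆ r → y ∈ r → p ∪ ⁅ y ⁆ ⊆ r
p∪⁅y⁆⊆ p⊆r y∈r x∈ = [ p⊆r , (λ { refl → y∈r }) ] (x∈p∪⁅y⁆⁻ x∈)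

p⊆p-y∪⁅y⁆ : ∀ p (y : Fin n) → p ⊆ (p - y) ∪ ⁅ y ⁆
p⊆p-y∪⁅y⁆ p y {x} x∈p with x ≟ y
... | yes refl = y∈p∪⁅y⁆ (p - y) y
... | no x≢y   = p⊆p∪q ⁅ y ⁆ (x∈p∧x≢y⇒x∈p-y x∈p x≢y)

p⊆q∪⁅y⁆⇒p⊆q : p ⊆ q ∪ ⁅ y ⁆ → y ∉ p → p ⊆ q
p⊆q∪⁅y⁆⇒p⊆q p⊆q+y y∉p x∈p =
  [ (λ x∈q → x∈q) , (λ { refl → ⊥-elim (y∉p x∈p) }) ] (x∈p∪⁅y⁆⁻ (p⊆q+y x∈p))

p⊆⁅y⁆⇒p⊆⊥ : p ⊆ ⁅ y ⁆ → p ≢ ⁅ y ⁆ → p ⊆ ⊥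
p⊆⁅y⁆⇒p⊆⊥ {y = y} p⊆⁅y⁆ p≢⁅y⁆ x∈p with x∈⁅y⁆⇒x≡y y (p⊆⁅y⁆ x∈p)
... | refl = ⊥-elim (p≢⁅y⁆ (⊆-antisym p⊆⁅y⁆ (y∈p⇒⁅y⁆⊆p x∈p)))

p-y∪⁅y⁆≡p : y ∈ p → (p - y) ∪ ⁅ y ⁆ ≡ p
p-y∪⁅y⁆≡p {y = y} {p = p} y∈p =
  ⊆-antisym (p∪⁅y⁆⊆ (p─q⊆p p ⁅ y ⁆) y∈p) (p⊆p-y∪⁅y⁆ p y)

p-y≡p : y ∉ p → p - y ≡ p
p-y≡p {y = y} {p = p} y∉p =
  ⊆-antisym (p─q⊆p p ⁅ y ⁆) (λ x∈p → x∈p∧x≢y⇒x∈p-y x∈p (λ { refl → y∉p x∈p }))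

p∪⁅y⁆-y≡p : y ∉ p → (p ∪ ⁅ y ⁆) - y ≡ p
p∪⁅y⁆-y≡p {y = y} {p = p} y∉p = ⊆-antisym
  (p⊆q∪⁅y⁆⇒p⊆q (p─q⊆p (p ∪ ⁅ y ⁆) ⁅ y ⁆) (y∉p-y (p ∪ ⁅ y ⁆) y))
  (λ x∈p → x∈p∧x≢y⇒x∈p-y (p⊆p∪q ⁅ y ⁆ x∈p) (λ { refl → y∉p x∈p }))

⊆-∪⁅⁆-cases : p ⊆ r → r ⊆ p ∪ ⁅ y ⁆ → r ≡ p ⊎ r ≡ p ∪ ⁅ y ⁆
⊆-∪⁅⁆-cases {p = p} {r = r} {y = y} p⊆r r⊆p+y with y ∈? r
... | yes y∈r = inj₂ (⊆-antisym r⊆p+y (p∪⁅y⁆⊆ p⊆r y∈r))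
... | no y∉r  = inj₁ (⊆-antisym (p⊆q∪⁅y⁆⇒p⊆q r⊆p+y y∉r) p⊆r)

⊆-missing : p ⊆ q → p ≢ q → ∃[ y ] (y ∈ q × y ∉ p)
⊆-missing {p = p} {q = q} p⊆q p≢q with any? (λ y → y ∈? q ×-dec ¬? (y ∈? p))
... | yes missing = missing
... | no none = ⊥-elim (p≢q (⊆-antisym p⊆q
        (λ {y} y∈q → decidable-stable (y ∈? p) (λ y∉p → none (y , y∈q , y∉p)))))

¬¬-∀-subset : {P : Subset n → Set} → (∀ X → ¬ ¬ P X) → ¬ ¬ (∀ X → P X)
¬¬-∀-subset {n = zero} ¬¬P ¬∀P = ¬¬P [] (λ P[] → ¬∀P (λ { [] → P[] }))
¬¬-∀-subset {n = suc n} {P} ¬¬P ¬∀P =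
  ¬¬-∀-subset {P = λ X → P (inside ∷ X) × P (outside ∷ X)}
    (λ X ¬both → ¬¬P (inside ∷ X) λ Pin → ¬¬P (outside ∷ X) λ Pout → ¬both (Pin , Pout))
    (λ ∀both → ¬∀P λ { (inside ∷ X) → proj₁ (∀both X) ; (outside ∷ X) → proj₂ (∀both X) })

module _ (P : Subset n → Set) (P? : ∀ X → Dec (P X)) where

  minimal-⊆ : ∀ X → P X →
    Σ[ Y ∈ Subset n ] (P Y × Y ⊆ X × ∀ y → y ∈ Y → ¬ P (Y - y))
  minimal-⊆ X = go X (⊂-wellFounded X)
    where
    go : ∀ Y → Acc _⊂_ Y → P Y →
      Σ[ Y′ ∈ Subset n ] (P Y′ × Y′ ⊆ Y × ∀ y → y ∈ Y′ → ¬ P (Y′ - y))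
    go Y (acc smaller) PY with any? (λ y → y ∈? Y ×-dec P? (Y - y))
    ... | no none = Y , PY , ⊆-refl , λ y y∈Y PY-y → none (y , y∈Y , PY-y)
    ... | yes (y , y∈Y , PY-y) =
      let (Y′ , PY′ , Y′⊆ , minY′) = go (Y - y) (smaller (x∈p⇒p-x⊂p y∈Y)) PY-y
      in Y′ , PY′ , ⊆-trans Y′⊆ (p─q⊆p Y ⁅ y ⁆) , minY′

  maximal-⊇ : ∀ X → P X →
    Σ[ Z ∈ Subset n ] (P Z × X ⊆ Z × ∀ z → z ∉ Z → ¬ P (Z ∪ ⁅ z ⁆))
  maximal-⊇ X = go X (⊃-wellFounded X)
    where
    go : ∀ Z → Acc _⊃_ Z → P Z →
      Σ[ Z′ ∈ Subset n ] (P Z′ × Z ⊆ Z′ × ∀ z → z ∉ Z′ → ¬ P (Z′ ∪ ⁅ z ⁆))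
    go Z (acc larger) PZ with any? (λ z → ¬? (z ∈? Z) ×-dec P? (Z ∪ ⁅ z ⁆))
    ... | no none = Z , PZ , ⊆-refl , λ z z∉Z PZ+z → none (z , z∉Z , PZ+z)
    ... | yes (z , z∉Z , PZ+z) =
      let Z⊂Z+z : Z ⊂ Z ∪ ⁅ z ⁆
          Z⊂Z+z = p⊆p∪q ⁅ z ⁆ , z , y∈p∪⁅y⁆ Z z , z∉Z
          (Z′ , PZ′ , ⊆Z′ , maxZ′) = go (Z ∪ ⁅ z ⁆) (larger Z⊂Z+z) PZ+z
      in Z′ , PZ′ , ⊆-trans (p⊆p∪q ⁅ z ⁆) ⊆Z′ , maxZ′

module _ (N : MatroidData n) (indep-↓ : ∀ X Y → Y ⊆ X → Indep N X → Indep N Y)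
         (indep? : ∀ X → Dec (Indep N X)) where

  dependent⇒circuit⊆ : ∀ X → X ⊆ E N → ¬ Indep N X →
    Σ[ C ∈ Subset n ] (Circuit N C × C ⊆ X)
  dependent⇒circuit⊆ X X⊆E dep with minimal-⊆ (¬_ ∘ Indep N) (¬? ∘ indep?) X dep
  ... | C , depC , C⊆X , minC = C , ((⊆-trans C⊆X X⊆E , depC) , proper-indep) , C⊆X
    where
    proper-indep : ∀ D → D ⊆ C → D ≢ C → Indep N D
    proper-indep D D⊆C D≢C =
      let (y , y∈C , y∉D) = ⊆-missing D⊆C D≢C
          D⊆C-y : D ⊆ C - y
          D⊆C-y x∈D = x∈p∧x≢y⇒x∈p-y (D⊆C x∈D) (λ { refl → y∉D x∈D })
      in indep-↓ (C - y) D D⊆C-y (decidable-stable (indep? (C - y)) (minC y y∈C))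

Δ-stable : (w : Fin n → ℚ) (N : MatroidData n) (I τ : Subset n) →
  ¬ ¬ Δ w N I τ → Δ w N I τ
Δ-stable w N I τ ¬¬Δ =
    (λ {x} x∈τ → decidable-stable (x ∈? E N) (¬¬-map (λ Δτ → proj₁ Δτ x∈τ) ¬¬Δ))
  , λ C B circC broken B⊆τ → ¬¬Δ (λ Δτ → proj₂ Δτ C B circC broken B⊆τ)

-- Independence is not assumed decidable. But membership in Δ is ¬¬-stable, and
-- decidability of the finitely many statements Indep M X holds under ¬¬.
Δ-classically : (w : Fin n → ℚ) (M : MatroidData n) {N : MatroidData n} {I τ : Subset n} →
  ((∀ X → Dec (Indep M X)) → Δ w N I τ) → Δ w N I τ
Δ-classically w M {N} {I} {τ} Δ-of-dec =
  Δ-stable w N I τ (¬¬-map Δ-of-dec (¬¬-∀-subset (λ X → ¬¬-excluded-middle)))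

module _ {M : MatroidData n} {i : Fin n} where

  circuit-deletion⁺ : ∀ {C} → i ∉ C → Circuit M C → Circuit (M ∖ i) C
  circuit-deletion⁺ i∉C ((C⊆E , depC) , minC) =
      ((λ x∈C → x∈p∧x≢y⇒x∈p-y (C⊆E x∈C) (λ { refl → i∉C x∈C })) , depC ∘ proj₂)
    , λ D D⊆C D≢C → i∉C ∘ D⊆C , minC D D⊆C D≢C

  circuit-deletion⁻ : ∀ {C} → Circuit (M ∖ i) C → Circuit M C
  circuit-deletion⁻ ((C⊆E-i , depC) , minC) =
      (proj₁ ∘ x∈p-y⁻ ∘ C⊆E-i , λ indC → depC (p⊆q-y⇒y∉p C⊆E-i , indC))
    , λ D D⊆C D≢C → proj₂ (minC D D⊆C D≢C)

module MatroidProperties {M : MatroidData n} (mat : IsMatroid M) where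
  open IsMatroid mat

  circuit-minus-indep : ∀ {C y} → Circuit M C → y ∈ C → Indep M (C - y)
  circuit-minus-indep {C} {y} (_ , minC) y∈C =
    minC (C - y) (p─q⊆p C ⁅ y ⁆) (λ C-y≡C → y∉p-y C y (subst (y ∈_) (sym C-y≡C) y∈C))

  loop⇒circuit : ∀ {i} → Loop M i → Circuit M ⁅ i ⁆
  loop⇒circuit (i∈E , dep⁅i⁆) =
      (y∈p⇒⁅y⁆⊆p i∈E , dep⁅i⁆)
    , λ D D⊆⁅i⁆ D≢⁅i⁆ → indep-↓ ⊥ D (p⊆⁅y⁆⇒p⊆⊥ D⊆⁅i⁆ D≢⁅i⁆) indep-∅

  module _ (indep? : ∀ X → Dec (Indep M X)) where

    indep⇒⊆basis : ∀ {X} → Indep M X → Σ[ Z ∈ Subset n ] (Basis M Z × X ⊆ Z)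
    indep⇒⊆basis {X} indX with maximal-⊇ (Indep M) indep? X indX
    ... | Z , indZ , X⊆Z , maxZ = Z , (indZ , maximal) , X⊆Z
      where
      maximal : ∀ Y → Indep M Y → Z ⊆ Y → Y ≡ Z
      maximal Y indY Z⊆Y = ⊆-antisym
        (λ {y} y∈Y → decidable-stable (y ∈? Z) λ y∉Z →
           maxZ y y∉Z (indep-↓ Y (Z ∪ ⁅ y ⁆) (p∪⁅y⁆⊆ Z⊆Y y∈Y) indY))
        Z⊆Y

    coloop⇒¬loop : ∀ {i} → Coloop M i → ¬ Loop M i
    coloop⇒¬loop (_ , i∈bases) (_ , dep⁅i⁆) =
      let (Z , basisZ , _) = indep⇒⊆basis indep-∅
      in dep⁅i⁆ (indep-↓ Z _ (y∈p⇒⁅y⁆⊆p (i∈bases Z basisZ)) (proj₁ basisZ))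

    coloop∉circuit : ∀ {i C} → Coloop M i → Circuit M C → i ∉ C
    coloop∉circuit {i} {C} (_ , i∈bases) circC i∈C =
      let (Z , basisZ , C-i⊆Z) = indep⇒⊆basis (circuit-minus-indep circC i∈C)
          C⊆Z = ⊆-trans (p⊆p-y∪⁅y⁆ C i) (p∪⁅y⁆⊆ C-i⊆Z (i∈bases Z basisZ))
      in proj₂ (proj₁ circC) (indep-↓ Z C C⊆Z (proj₁ basisZ))

module Contraction {M : MatroidData n} (mat : IsMatroid M) (indep? : ∀ X → Dec (Indep M X))
                   {i : Fin n} (i∈E : i ∈ E M) (¬loop : ¬ Loop M i) where
  open IsMatroid mat
  open MatroidProperties mat

  contraction-indep⁺ : ∀ {X} → i ∉ X → Indep M (X ∪ ⁅ i ⁆) → Indep (M / i) X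
  contraction-indep⁺ i∉X indX+i = i∉X , ⊥-elim ∘ ¬loop , λ _ → indX+i

  contraction-indep⁻ : ∀ {X} → Indep (M / i) X → Indep M (X ∪ ⁅ i ⁆)
  contraction-indep⁻ (_ , _ , indX+i) = indX+i ¬loop

  contraction-↓ : ∀ X Y → Y ⊆ X → Indep (M / i) X → Indep (M / i) Y
  contraction-↓ X Y Y⊆X indX@(i∉X , _) =
    contraction-indep⁺ (i∉X ∘ Y⊆X)
      (indep-↓ (X ∪ ⁅ i ⁆) (Y ∪ ⁅ i ⁆) (p∪⁅y⁆⊆ (⊆-trans Y⊆X (p⊆p∪q ⁅ i ⁆)) (y∈p∪⁅y⁆ X i))
               (contraction-indep⁻ indX))

  contraction-indep? : ∀ X → Dec (Indep (M / i) X)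
  contraction-indep? X =
    Dec.map′ (λ (i∉X , indX+i) → contraction-indep⁺ i∉X indX+i)
             (λ indX → proj₁ indX , contraction-indep⁻ indX)
             (¬? (i ∈? X) ×-dec indep? (X ∪ ⁅ i ⁆))

  indep⁅i⁆ : Indep M ⁅ i ⁆
  indep⁅i⁆ = decidable-stable (indep? ⁅ i ⁆) (λ dep → ¬loop (i∈E , dep))

  circuit⊈⁅i⁆ : ∀ {C} → Circuit M C → ¬ C ⊆ ⁅ i ⁆
  circuit⊈⁅i⁆ {C} ((_ , depC) , _) C⊆⁅i⁆ = depC (indep-↓ ⁅ i ⁆ C C⊆⁅i⁆ indep⁅i⁆)

  circuit-contraction⁺ : ∀ {C} → Circuit M C → i ∈ C → Circuit (M / i) (C - i)
  circuit-contraction⁺ {C} ((C⊆E , depC) , minC) i∈C =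
      ( (λ x∈C-i → let (x∈C , x≢i) = x∈p-y⁻ x∈C-i in x∈p∧x≢y⇒x∈p-y (C⊆E x∈C) x≢i)
      , λ indC-i → depC (subst (Indep M) (p-y∪⁅y⁆≡p i∈C) (contraction-indep⁻ indC-i)))
    , λ D D⊆C-i D≢C-i →
        let i∉D = p⊆q-y⇒y∉p D⊆C-i
            D+i⊆C = p∪⁅y⁆⊆ (⊆-trans D⊆C-i (p─q⊆p C ⁅ i ⁆)) i∈C
            D+i≢C = λ D+i≡C → D≢C-i (trans (sym (p∪⁅y⁆-y≡p i∉D)) (cong (_- i) D+i≡C))
        in contraction-indep⁺ i∉D (minC (D ∪ ⁅ i ⁆) D+i⊆C D+i≢C)

  circuit-contraction⁻ : ∀ {C} → Circuit (M / i) C → Circuit M C ⊎ Circuit M (C ∪ ⁅ i ⁆)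
  circuit-contraction⁻ {C} ((C⊆E-i , depC) , minC)
    with dependent⇒circuit⊆ M indep-↓ indep? (C ∪ ⁅ i ⁆)
           (p∪⁅y⁆⊆ (proj₁ ∘ x∈p-y⁻ ∘ C⊆E-i) i∈E) (depC ∘ contraction-indep⁺ (p⊆q-y⇒y∉p C⊆E-i))
  ... | C′ , circC′@((_ , depC′) , _) , C′⊆C+i =
    Sum.map (λ C′≡C → subst (Circuit M) C′≡C circC′) (λ C′≡C+i → subst (Circuit M) C′≡C+i circC′)
            (⊆-∪⁅⁆-cases C⊆C′ C′⊆C+i)
    where
    C′-i⊆C : C′ - i ⊆ C
    C′-i⊆C = p⊆q∪⁅y⁆⇒p⊆q (⊆-trans (p─q⊆p C′ ⁅ i ⁆) C′⊆C+i) (y∉p-y C′ i)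
    C⊆C′ : C ⊆ C′
    C⊆C′ {x} x∈C = decidable-stable (x ∈? C′) λ x∉C′ →
      let C′-i≢C = λ C′-i≡C → x∉C′ (proj₁ (x∈p-y⁻ (subst (x ∈_) (sym C′-i≡C) x∈C)))
      in depC′ (indep-↓ ((C′ - i) ∪ ⁅ i ⁆) C′ (p⊆p-y∪⁅y⁆ C′ i)
                  (contraction-indep⁻ (minC (C′ - i) C′-i⊆C C′-i≢C)))

  -- Take Z maximal independent with i ∈ Z ⊆ (C - m) ∪ {i}. Then (Z - i) ∪ {m} is dependent
  -- in M / i, and each of its M / i-circuits contains m because Z - i is independent there.
  module Cover {C : Subset n} {m : Fin n} (circC : Circuit M C) (i∉C : i ∉ C) (m∈C : m ∈ C) where
    private
      X : Subset n
      X = C - m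

      indX : Indep M X
      indX = circuit-minus-indep circC m∈C

      depC : ¬ Indep M C
      depC = proj₂ (proj₁ circC)

      C⊆X+m : C ⊆ X ∪ ⁅ m ⁆
      C⊆X+m = p⊆p-y∪⁅y⁆ C m

      Admissible : Subset n → Set
      Admissible Z = Indep M Z × Z ⊆ X ∪ ⁅ i ⁆ × i ∈ Z

      maximal : Σ[ Z ∈ Subset n ]
        (Admissible Z × ⁅ i ⁆ ⊆ Z × ∀ z → z ∉ Z → ¬ Admissible (Z ∪ ⁅ z ⁆))
      maximal = maximal-⊇ Admissible (λ Z → indep? Z ×-dec (Z ⊆? X ∪ ⁅ i ⁆) ×-dec (i ∈? Z))
                  ⁅ i ⁆ (indep⁅i⁆ , q⊆p∪q X ⁅ i ⁆ , x∈⁅x⁆ i)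

      Z : Subset n
      Z = proj₁ maximal

      indZ : Indep M Z
      indZ = proj₁ (proj₁ (proj₂ maximal))

      Z⊆X+i : Z ⊆ X ∪ ⁅ i ⁆
      Z⊆X+i = proj₁ (proj₂ (proj₁ (proj₂ maximal)))

      i∈Z : i ∈ Z
      i∈Z = proj₂ (proj₂ (proj₁ (proj₂ maximal)))

      Z-i⊆X : Z - i ⊆ X
      Z-i⊆X = p⊆q∪⁅y⁆⇒p⊆q (⊆-trans (p─q⊆p Z ⁅ i ⁆) Z⊆X+i) (y∉p-y Z i)

      m≢i : m ≢ i
      m≢i refl = i∉C m∈C

      m∉Z : m ∉ Z
      m∉Z m∈Z = [ y∉p-y C m , m≢i ] (x∈p∪⁅y⁆⁻ (Z⊆X+i m∈Z))

      X-dependent-on-Z : ∀ y → y ∈ X → y ∉ Z → ¬ Indep M (Z ∪ ⁅ y ⁆)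
      X-dependent-on-Z y y∈X y∉Z indZ+y =
        proj₂ (proj₂ (proj₂ maximal)) y y∉Z
          (indZ+y , p∪⁅y⁆⊆ Z⊆X+i (p⊆p∪q ⁅ i ⁆ y∈X) , p⊆p∪q ⁅ y ⁆ i∈Z)

      ∣X∣≤∣Z∣ : ∣ X ∣ ≤ ∣ Z ∣
      ∣X∣≤∣Z∣ with ∣ X ∣ ≤? ∣ Z ∣
      ... | yes ≤ = ≤
      ... | no ≰ = let (y , y∈X , y∉Z , indZ+y) = indep-aug Z X indZ indX (≰⇒> ≰)
                   in ⊥-elim (X-dependent-on-Z y y∈X y∉Z indZ+y)

      -- Otherwise X is augmented from Z ∪ {m}: by m, making C independent, or by i,
      -- which forces X ⊆ Z.
      Z+m-dependent : ¬ Indep M (Z ∪ ⁅ m ⁆)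
      Z+m-dependent indZ+m
        with indep-aug X (Z ∪ ⁅ m ⁆) indX indZ+m
               (≤-<-trans ∣X∣≤∣Z∣ (p⊂q⇒∣p∣<∣q∣ (p⊆p∪q ⁅ m ⁆ , m , y∈p∪⁅y⁆ Z m , m∉Z)))
      ... | y , y∈Z+m , y∉X , indX+y with x∈p∪⁅y⁆⁻ y∈Z+m
      ...   | inj₂ refl = depC (indep-↓ (X ∪ ⁅ m ⁆) C C⊆X+m indX+y)
      ...   | inj₁ y∈Z with x∈p∪⁅y⁆⁻ (Z⊆X+i y∈Z)
      ...     | inj₁ y∈X = y∉X y∈X
      ...     | inj₂ refl = depC (indep-↓ (Z ∪ ⁅ m ⁆) C C⊆Z+m indZ+m)
        where
        X⊆Z : X ⊆ Z
        X⊆Z {x} x∈X = decidable-stable (x ∈? Z) λ x∉Z →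
          X-dependent-on-Z x x∈X x∉Z
            (indep-↓ (X ∪ ⁅ i ⁆) (Z ∪ ⁅ x ⁆) (p∪⁅y⁆⊆ Z⊆X+i (p⊆p∪q ⁅ i ⁆ x∈X)) indX+y)
        C⊆Z+m : C ⊆ Z ∪ ⁅ m ⁆
        C⊆Z+m = ⊆-trans C⊆X+m (p∪⁅y⁆⊆ (⊆-trans X⊆Z (p⊆p∪q ⁅ m ⁆)) (y∈p∪⁅y⁆ Z m))

      D : Subset n
      D = (Z - i) ∪ ⁅ m ⁆

      D⊆E-i : D ⊆ E M - i
      D⊆E-i = p∪⁅y⁆⊆
        (λ x∈ → let (x∈Z , x≢i) = x∈p-y⁻ x∈ in x∈p∧x≢y⇒x∈p-y (indep-⊆E Z indZ x∈Z) x≢i)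
        (x∈p∧x≢y⇒x∈p-y (proj₁ (proj₁ circC) m∈C) m≢i)

      Z+m⊆D+i : Z ∪ ⁅ m ⁆ ⊆ D ∪ ⁅ i ⁆
      Z+m⊆D+i = p∪⁅y⁆⊆
        (⊆-trans (p⊆p-y∪⁅y⁆ Z i) (p∪⁅y⁆⊆ (⊆-trans (p⊆p∪q ⁅ m ⁆) (p⊆p∪q ⁅ i ⁆)) (y∈p∪⁅y⁆ D i)))
        (p⊆p∪q ⁅ i ⁆ (y∈p∪⁅y⁆ (Z - i) m))

      circuit⊆D : Σ[ C* ∈ Subset n ] (Circuit (M / i) C* × C* ⊆ D)
      circuit⊆D = dependent⇒circuit⊆ (M / i) contraction-↓ contraction-indep? D D⊆E-i
        (λ indD → Z+m-dependent (indep-↓ (D ∪ ⁅ i ⁆) (Z ∪ ⁅ m ⁆) Z+m⊆D+i (contraction-indep⁻ indD)))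

    C* : Subset n
    C* = proj₁ circuit⊆D

    circC* : Circuit (M / i) C*
    circC* = proj₁ (proj₂ circuit⊆D)

    m∈C* : m ∈ C*
    m∈C* = decidable-stable (m ∈? C*) λ m∉C* →
      let C*⊆Z-i = p⊆q∪⁅y⁆⇒p⊆q (proj₂ (proj₂ circuit⊆D)) m∉C*
          C*+i⊆Z = p∪⁅y⁆⊆ (⊆-trans C*⊆Z-i (p─q⊆p Z ⁅ i ⁆)) i∈Z
      in proj₂ (proj₁ circC*)
           (contraction-indep⁺ (p⊆q-y⇒y∉p C*⊆Z-i) (indep-↓ Z (C* ∪ ⁅ i ⁆) C*+i⊆Z indZ))

    C*⊆C : C* ⊆ C
    C*⊆C = ⊆-trans (proj₂ (proj₂ circuit⊆D))
                   (p∪⁅y⁆⊆ (⊆-trans Z-i⊆X (p─q⊆p C ⁅ m ⁆)) m∈C)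

  circuit-contraction-cover : ∀ {C m} → Circuit M C → i ∉ C → m ∈ C →
    Σ[ C* ∈ Subset n ] (Circuit (M / i) C* × m ∈ C* × C* ⊆ C)
  circuit-contraction-cover circC i∉C m∈C = C* , circC* , m∈C* , C*⊆C
    where open Cover circC i∉C m∈C

module _ (w : Fin n → ℚ) where

  broken⊆circuit : ∀ {I C B} → BrokenOf w I C B → B ⊆ C
  broken⊆circuit {C = C} (inj₁ (_ , m , _ , refl)) = p─q⊆p C ⁅ m ⁆
  broken⊆circuit {I} {C} (inj₂ (_ , m , (m∈C─I , _) , refl)) =
    p∪⁅y⁆⊆ (p∩q⊆p C I) (proj₁ (x∈p─q⁻ C I m∈C─I))

  broken-cong : ∀ {I K C B} → (∀ {x} → x ∈ C → x ∈ I ⇔ x ∈ K) →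
    BrokenOf w I C B → BrokenOf w K C B
  broken-cong {I} {K} {C} agree (inj₁ (C⊆I , m , min , B≡)) =
    inj₁ ((λ x∈C → Equivalence.to (agree x∈C) (C⊆I x∈C)) , m , min , B≡)
  broken-cong {I} {K} {C} agree (inj₂ (C⊈I , m , (m∈C─I , max) , B≡)) =
    inj₂ ( (λ C⊆K → C⊈I (λ x∈C → Equivalence.from (agree x∈C) (C⊆K x∈C)))
         , m , (C─I⊆C─K m∈C─I , λ x x∈C─K → max x (C─K⊆C─I x∈C─K))
         , trans B≡ (cong (_∪ ⁅ m ⁆) (⊆-antisym C∩I⊆C∩K C∩K⊆C∩I)) )
    where
    C─I⊆C─K : C ─ I ⊆ C ─ K
    C─I⊆C─K x∈ = let (x∈C , x∉I) = x∈p─q⁻ C I x∈ in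
      x∈p∧x∉q⇒x∈p─q x∈C (x∉I ∘ Equivalence.from (agree x∈C))
    C─K⊆C─I : C ─ K ⊆ C ─ I
    C─K⊆C─I x∈ = let (x∈C , x∉K) = x∈p─q⁻ C K x∈ in
      x∈p∧x∉q⇒x∈p─q x∈C (x∉K ∘ Equivalence.to (agree x∈C))
    C∩I⊆C∩K : C ∩ I ⊆ C ∩ K
    C∩I⊆C∩K x∈ = let (x∈C , x∈I) = x∈p∩q⁻ C I x∈ in
      x∈p∩q⁺ (x∈C , Equivalence.to (agree x∈C) x∈I)
    C∩K⊆C∩I : C ∩ K ⊆ C ∩ I
    C∩K⊆C∩I x∈ = let (x∈C , x∈K) = x∈p∩q⁻ C K x∈ in
      x∈p∩q⁺ (x∈C , Equivalence.from (agree x∈C) x∈K)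

  broken-avoiding : ∀ {I C B i} → i ∉ C → BrokenOf w I C B → BrokenOf w (I - i) C B
  broken-avoiding i∉C = broken-cong (λ x∈C → x∈p⇔x∈p-y (λ { refl → i∉C x∈C }))

  broken-avoiding⁻ : ∀ {I C B i} → i ∉ C → BrokenOf w (I - i) C B → BrokenOf w I C B
  broken-avoiding⁻ i∉C = broken-cong (λ x∈C → ⇔-sym (x∈p⇔x∈p-y (λ { refl → i∉C x∈C })))

  broken-restrict : (Q : Subset n → Set) → ∀ {I C B} → BrokenOf w I C B →
    (∀ m → m ∈ C → Σ[ C* ∈ Subset n ] (Q C* × m ∈ C* × C* ⊆ C)) →
    Σ[ C* ∈ Subset n ] Σ[ B* ∈ Subset n ] (Q C* × BrokenOf w I C* B* × B* ⊆ B)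
  broken-restrict Q {I} {C} (inj₁ (C⊆I , m , (m∈C , min) , refl)) cover =
    let (C* , QC* , m∈C* , C*⊆C) = cover m m∈C
    in C* , C* - m , QC*
     , inj₁ (⊆-trans C*⊆C C⊆I , m , (m∈C* , λ x → min x ∘ C*⊆C) , refl)
     , λ x∈ → let (x∈C* , x≢m) = x∈p-y⁻ x∈ in x∈p∧x≢y⇒x∈p-y (C*⊆C x∈C*) x≢m
  broken-restrict Q {I} {C} (inj₂ (_ , m , (m∈C─I , max) , refl)) cover =
    let (m∈C , m∉I) = x∈p─q⁻ C I m∈C─I
        (C* , QC* , m∈C* , C*⊆C) = cover m m∈C
        C*─I⊆C─I : C* ─ I ⊆ C ─ I
        C*─I⊆C─I x∈ = let (x∈C* , x∉I) = x∈p─q⁻ C* I x∈ in x∈p∧x∉q⇒x∈p─q (C*⊆C x∈C*) x∉I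
        C*∩I⊆C∩I : C* ∩ I ⊆ C ∩ I
        C*∩I⊆C∩I x∈ = let (x∈C* , x∈I) = x∈p∩q⁻ C* I x∈ in x∈p∩q⁺ (C*⊆C x∈C* , x∈I)
    in C* , (C* ∩ I) ∪ ⁅ m ⁆ , QC*
     , inj₂ ( (λ C*⊆I → m∉I (C*⊆I m∈C*)) , m
            , (x∈p∧x∉q⇒x∈p─q m∈C* m∉I , λ x → max x ∘ C*─I⊆C─I) , refl )
     , p∪⁅y⁆⊆ (⊆-trans C*∩I⊆C∩I (p⊆p∪q ⁅ m ⁆)) (y∈p∪⁅y⁆ (C ∩ I) m)

  broken-insert-max : ∀ {I C B i} → i ∉ C → IsMax w I i → BrokenOf w (I - i) C B →
    Σ[ B′ ∈ Subset n ] (BrokenOf w I (C ∪ ⁅ i ⁆) B′ × B′ ⊆ B ∪ ⁅ i ⁆)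
  broken-insert-max {I} {C} {i = i} i∉C (i∈I , max-i) (inj₁ (C⊆I-i , m , (m∈C , min) , refl)) =
      (C ∪ ⁅ i ⁆) - m
    , inj₁ ( p∪⁅y⁆⊆ (⊆-trans C⊆I-i (p─q⊆p I ⁅ i ⁆)) i∈I , m
           , (p⊆p∪q ⁅ i ⁆ m∈C , min′) , refl )
    , λ x∈ → let (x∈C+i , x≢m) = x∈p-y⁻ x∈ in
        [ (λ x∈C → p⊆p∪q ⁅ i ⁆ (x∈p∧x≢y⇒x∈p-y x∈C x≢m)) , (λ { refl → y∈p∪⁅y⁆ (C - m) i }) ]
          (x∈p∪⁅y⁆⁻ x∈C+i)
    where
    min′ : ∀ x → x ∈ C ∪ ⁅ i ⁆ → w m ≤ℚ w x
    min′ x x∈ with x∈p∪⁅y⁆⁻ x∈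
    ... | inj₁ x∈C = min x x∈C
    ... | inj₂ refl = max-i m (p─q⊆p I ⁅ i ⁆ (C⊆I-i m∈C))
  broken-insert-max {I} {C} {i = i} i∉C (i∈I , _) (inj₂ (C⊈I-i , m , (m∈C─I-i , max) , refl)) =
      ((C ∪ ⁅ i ⁆) ∩ I) ∪ ⁅ m ⁆
    , inj₂ ( (λ C+i⊆I → C⊈I-i (λ x∈C → ∈I-i x∈C (C+i⊆I (p⊆p∪q ⁅ i ⁆ x∈C))))
           , m , (x∈p∧x∉q⇒x∈p─q (p⊆p∪q ⁅ i ⁆ m∈C) (m∉I-i ∘ ∈I-i m∈C) , max′) , refl )
    , p∪⁅y⁆⊆ C+i∩I⊆ (p⊆p∪q ⁅ i ⁆ (y∈p∪⁅y⁆ (C ∩ (I - i)) m))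
    where
    m∈C = proj₁ (x∈p─q⁻ C (I - i) m∈C─I-i)
    m∉I-i = proj₂ (x∈p─q⁻ C (I - i) m∈C─I-i)
    ∈I-i : ∀ {x} → x ∈ C → x ∈ I → x ∈ I - i
    ∈I-i x∈C = Equivalence.to (x∈p⇔x∈p-y (λ { refl → i∉C x∈C }))
    max′ : ∀ x → x ∈ (C ∪ ⁅ i ⁆) ─ I → w x ≤ℚ w m
    max′ x x∈ with x∈p─q⁻ (C ∪ ⁅ i ⁆) I x∈
    ... | x∈C+i , x∉I with x∈p∪⁅y⁆⁻ x∈C+i
    ...   | inj₁ x∈C = max x (x∈p∧x∉q⇒x∈p─q x∈C (x∉I ∘ p─q⊆p I ⁅ i ⁆))
    ...   | inj₂ refl = ⊥-elim (x∉I i∈I)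
    C+i∩I⊆ : (C ∪ ⁅ i ⁆) ∩ I ⊆ ((C ∩ (I - i)) ∪ ⁅ m ⁆) ∪ ⁅ i ⁆
    C+i∩I⊆ x∈ with x∈p∩q⁻ (C ∪ ⁅ i ⁆) I x∈
    ... | x∈C+i , x∈I with x∈p∪⁅y⁆⁻ x∈C+i
    ...   | inj₁ x∈C = p⊆p∪q ⁅ i ⁆ (p⊆p∪q ⁅ m ⁆ (x∈p∩q⁺ (x∈C , ∈I-i x∈C x∈I)))
    ...   | inj₂ refl = y∈p∪⁅y⁆ _ i

  broken-remove-max : (∀ x y → w x ≡ w y → x ≡ y) → ∀ {I C B i} →
    i ∈ C → IsMax w I i → ¬ C ⊆ ⁅ i ⁆ → BrokenOf w I C B →
    i ∈ B × Σ[ B′ ∈ Subset n ] (BrokenOf w (I - i) (C - i) B′ × B′ ⊆ B)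
  broken-remove-max w-inj {I} {C} {i = i} i∈C (i∈I , max-i) C⊈⁅i⁆
                    (inj₁ (C⊆I , m , (m∈C , min) , refl)) =
      x∈p∧x≢y⇒x∈p-y i∈C (m≢i ∘ sym)
    , C - i - m
    , inj₁ ( (λ x∈ → let (x∈C , x≢i) = x∈p-y⁻ x∈ in x∈p∧x≢y⇒x∈p-y (C⊆I x∈C) x≢i) , m
           , (x∈p∧x≢y⇒x∈p-y m∈C m≢i , λ x → min x ∘ proj₁ ∘ x∈p-y⁻) , refl )
    , λ x∈ → let (x∈C-i , x≢m) = x∈p-y⁻ x∈ in x∈p∧x≢y⇒x∈p-y (proj₁ (x∈p-y⁻ x∈C-i)) x≢m
    where
    m≢i : m ≢ i
    m≢i refl = C⊈⁅i⁆ λ {x} x∈C →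
      Equivalence.from x∈⁅y⁆⇔x≡y (w-inj x m (ℚ.≤-antisym (max-i x (C⊆I x∈C)) (min x x∈C)))
  broken-remove-max w-inj {I} {C} {i = i} i∈C (i∈I , _) _
                    (inj₂ (C⊈I , m , (m∈C─I , max) , refl)) =
      p⊆p∪q ⁅ m ⁆ (x∈p∩q⁺ (i∈C , i∈I))
    , ((C - i) ∩ (I - i)) ∪ ⁅ m ⁆
    , inj₂ ( (λ C-i⊆I-i → C⊈I (⊆-trans (p⊆p-y∪⁅y⁆ C i)
                                        (p∪⁅y⁆⊆ (⊆-trans C-i⊆I-i (p─q⊆p I ⁅ i ⁆)) i∈I)))
           , m , (x∈p∧x∉q⇒x∈p─q (x∈p∧x≢y⇒x∈p-y m∈C m≢i) (m∉I ∘ p─q⊆p I ⁅ i ⁆) , max′) , refl )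
    , p∪⁅y⁆⊆ (⊆-trans C-i∩I-i⊆C∩I (p⊆p∪q ⁅ m ⁆)) (y∈p∪⁅y⁆ (C ∩ I) m)
    where
    m∈C = proj₁ (x∈p─q⁻ C I m∈C─I)
    m∉I = proj₂ (x∈p─q⁻ C I m∈C─I)
    m≢i : m ≢ i
    m≢i refl = m∉I i∈I
    max′ : ∀ x → x ∈ (C - i) ─ (I - i) → w x ≤ℚ w m
    max′ x x∈ = let (x∈C-i , x∉I-i) = x∈p─q⁻ (C - i) (I - i) x∈
                    (x∈C , x≢i) = x∈p-y⁻ x∈C-i
                in max x (x∈p∧x∉q⇒x∈p─q x∈C (x∉I-i ∘ Equivalence.to (x∈p⇔x∈p-y x≢i)))
    C-i∩I-i⊆C∩I : (C - i) ∩ (I - i) ⊆ C ∩ I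
    C-i∩I-i⊆C∩I x∈ = let (x∈C-i , x∈I-i) = x∈p∩q⁻ (C - i) (I - i) x∈ in
      x∈p∩q⁺ (p─q⊆p C ⁅ i ⁆ x∈C-i , p─q⊆p I ⁅ i ⁆ x∈I-i)

cone-intro : ∀ (P : Subset n → Set) i τ → P (τ - i) → cone P i τ
cone-intro P i τ Pτ-i with i ∈? τ
... | yes i∈τ = inj₂ (τ - i , Pτ-i , sym (p-y∪⁅y⁆≡p i∈τ))
... | no i∉τ  = inj₁ (subst P (p-y≡p i∉τ) Pτ-i)

module _ (w : Fin n → ℚ) {M : MatroidData n} {I : Subset n} where

  Δ-loop : IsMatroid M → ∀ {i τ} → i ∈ I → Loop M i → ¬ Δ w M I τ
  Δ-loop mat {i} i∈I loop (_ , no-broken) =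
    no-broken ⁅ i ⁆ (⁅ i ⁆ - i) (MatroidProperties.loop⇒circuit mat loop)
      (inj₁ (y∈p⇒⁅y⁆⊆p i∈I , i , (x∈⁅x⁆ i , min-i) , refl))
      (λ x∈ → let (x∈⁅i⁆ , x≢i) = x∈p-y⁻ x∈ in ⊥-elim (x≢i (x∈⁅y⁆⇒x≡y i x∈⁅i⁆)))
    where
    min-i : ∀ x → x ∈ ⁅ i ⁆ → w i ≤ℚ w x
    min-i x x∈⁅i⁆ with x∈⁅y⁆⇒x≡y i x∈⁅i⁆
    ... | refl = ℚ.≤-refl

  Δ-deletion : ∀ {i τ} → i ∉ τ → Δ w M I τ → Δ w (M ∖ i) (I - i) τ
  Δ-deletion i∉τ (τ⊆E , no-broken) =
      (λ x∈τ → x∈p∧x≢y⇒x∈p-y (τ⊆E x∈τ) (λ { refl → i∉τ x∈τ }))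
    , λ C B circC broken → no-broken C B (circuit-deletion⁻ circC)
                             (broken-avoiding⁻ w (p⊆q-y⇒y∉p (proj₁ (proj₁ circC))) broken)

module DeletionContraction {M : MatroidData n} (mat : IsMatroid M)
                           (indep? : ∀ X → Dec (Indep M X))
                           {i : Fin n} (i∈E : i ∈ E M) (¬loop : ¬ Loop M i)
                           (w : Fin n → ℚ) {I : Subset n} where
  open Contraction mat indep? i∈E ¬loop

  Δ-contraction : ∀ {τ} → (∀ C → Circuit M C → i ∈ C → IsMax w I i × i ∈ τ) →
    Δ w M I τ → Δ w (M / i) (I - i) (τ - i)
  Δ-contraction {τ} max-in-τ (τ⊆E , no-broken) =
      (λ x∈ → let (x∈τ , x≢i) = x∈p-y⁻ x∈ in x∈p∧x≢y⇒x∈p-y (τ⊆E x∈τ) x≢i)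
    , λ C′ B′ circC′ broken B′⊆τ-i →
        let i∉C′ = p⊆q-y⇒y∉p (proj₁ (proj₁ circC′))
            B′⊆τ = ⊆-trans B′⊆τ-i (p─q⊆p τ ⁅ i ⁆)
        in [ (λ circC → no-broken C′ B′ circC (broken-avoiding⁻ w i∉C′ broken) B′⊆τ)
           , (λ circC+i →
               let (max-i , i∈τ) = max-in-τ (C′ ∪ ⁅ i ⁆) circC+i (y∈p∪⁅y⁆ C′ i)
                   (B , brokenB , B⊆B′+i) = broken-insert-max w i∉C′ max-i broken
               in no-broken (C′ ∪ ⁅ i ⁆) B circC+i brokenB
                    (⊆-trans B⊆B′+i (p∪⁅y⁆⊆ B′⊆τ i∈τ))) ]
           (circuit-contraction⁻ circC′)

  module _ (w-inj : ∀ x y → w x ≡ w y → x ≡ y) where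

    Δ-of-contraction : ∀ {σ τ} → (∀ C → Circuit M C → i ∈ C → IsMax w I i) →
      Δ w (M / i) (I - i) σ → τ ⊆ σ ∪ ⁅ i ⁆ → Δ w M I τ
    Δ-of-contraction {σ} {τ} max-i (σ⊆E-i , no-broken) τ⊆σ+i =
        ⊆-trans τ⊆σ+i (p∪⁅y⁆⊆ (⊆-trans σ⊆E-i (p─q⊆p (E M) ⁅ i ⁆)) i∈E)
      , λ C B circC broken B⊆τ → case i ∈? C of λ where
          (yes i∈C) →
            let (_ , B′ , brokenB′ , B′⊆B) =
                  broken-remove-max w w-inj i∈C (max-i C circC i∈C) (circuit⊈⁅i⁆ circC) broken
            in no-broken (C - i) B′ (circuit-contraction⁺ circC i∈C) brokenB′
                 (⊆σ (⊆-trans B′⊆B B⊆τ) (p⊆q-y⇒y∉p (broken⊆circuit w brokenB′)))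
          (no i∉C) →
            let (C* , B* , circC* , brokenB* , B*⊆B) =
                  broken-restrict w (Circuit (M / i)) broken
                    (λ m m∈C → circuit-contraction-cover circC i∉C m∈C)
                i∉C* = p⊆q-y⇒y∉p (proj₁ (proj₁ circC*))
            in no-broken C* B* circC* (broken-avoiding w i∉C* brokenB*)
                 (⊆σ (⊆-trans B*⊆B B⊆τ) (i∉C ∘ broken⊆circuit w broken ∘ B*⊆B))
      where
      ⊆σ : ∀ {X} → X ⊆ τ → i ∉ X → X ⊆ σ
      ⊆σ X⊆τ = p⊆q∪⁅y⁆⇒p⊆q (⊆-trans X⊆τ τ⊆σ+i)

    Δ-of-cone : ∀ {τ} → (∀ C → Circuit M C → i ∈ C → IsMax w I i) →
      cone (Δ w (M / i) (I - i)) i τ → Δ w M I τ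
    Δ-of-cone max-i (inj₁ Δτ)              = Δ-of-contraction max-i Δτ (p⊆p∪q ⁅ i ⁆)
    Δ-of-cone max-i (inj₂ (σ , Δσ , refl)) = Δ-of-contraction max-i Δσ ⊆-refl

    Δ-of-deletion : ∀ {τ} → IsMax w I i → Δ w (M ∖ i) (I - i) τ → Δ w M I τ
    Δ-of-deletion max-i (τ⊆E-i , no-broken) =
        ⊆-trans τ⊆E-i (p─q⊆p (E M) ⁅ i ⁆)
      , λ C B circC broken B⊆τ → case i ∈? C of λ where
          (yes i∈C) →
            let (i∈B , _) = broken-remove-max w w-inj i∈C max-i (circuit⊈⁅i⁆ circC) broken
            in p⊆q-y⇒y∉p τ⊆E-i (B⊆τ i∈B)
          (no i∉C) →
            no-broken C B (circuit-deletion⁺ i∉C circC) (broken-avoiding w i∉C broken) B⊆τ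

module _ {M : MatroidData n} (mat : IsMatroid M)
         (w : Fin n → ℚ) (w-inj : ∀ x y → w x ≡ w y → x ≡ y)
         {I : Subset n} {i : Fin n} (i∈E : i ∈ E M) where
  open MatroidProperties mat
  private
    module DC indep? (¬loop : ¬ Loop M i) = DeletionContraction mat indep? i∈E ¬loop w {I}

  Δ-coloop : Coloop M i → ∀ τ → Δ w M I τ ⇔ cone (Δ w (M / i) (I - i)) i τ
  Δ-coloop coloop τ = mk⇔
    (λ Δτ → cone-intro _ i τ (Δ-classically w M λ indep? →
      DC.Δ-contraction indep? (coloop⇒¬loop indep? coloop) (no-circuit-through-i indep?) Δτ))
    (λ coneτ → Δ-classically w M λ indep? →
      DC.Δ-of-cone indep? (coloop⇒¬loop indep? coloop) w-inj (no-circuit-through-i indep?) coneτ)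
    where
    no-circuit-through-i : ∀ {A : Set} indep? C → Circuit M C → i ∈ C → A
    no-circuit-through-i indep? C circC i∈C = ⊥-elim (coloop∉circuit indep? coloop circC i∈C)

  Δ-max : IsMax w I i → ¬ Loop M i →
    ∀ τ → Δ w M I τ ⇔ (Δ w (M ∖ i) (I - i) τ ⊎ cone (Δ w (M / i) (I - i)) i τ)
  Δ-max max-i ¬loop τ = mk⇔ to
    [ (λ Δτ → Δ-classically w M λ indep? → DC.Δ-of-deletion indep? ¬loop w-inj max-i Δτ)
    , (λ coneτ → Δ-classically w M λ indep? →
         DC.Δ-of-cone indep? ¬loop w-inj (λ _ _ _ → max-i) coneτ) ]
    where
    to : Δ w M I τ → Δ w (M ∖ i) (I - i) τ ⊎ cone (Δ w (M / i) (I - i)) i τ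
    to Δτ with i ∈? τ
    ... | no i∉τ  = inj₁ (Δ-deletion w i∉τ Δτ)
    ... | yes i∈τ = inj₂ (cone-intro _ i τ (Δ-classically w M λ indep? →
                      DC.Δ-contraction indep? ¬loop (λ _ _ _ → max-i , i∈τ) Δτ))

theorem3p2 : (n : ℕ) (M : MatroidData n) → IsMatroid M → E M ≡ ⊤ →
    (I : Subset n) (w : Fin n → ℚ) → (∀ i j → w i ≡ w j → i ≡ j) →
    ((∀ i → i ∈ I → Loop M i → ∀ τ → ¬ Δ w M I τ)
    × (∀ i → i ∈ I → Coloop M i →
         ∀ τ → Δ w M I τ ⇔ cone (Δ w (M / i) (I - i)) i τ)
    × (∀ i → IsMax w I i → ¬ Loop M i → ¬ Coloop M i →
         ∀ τ → Δ w M I τ ⇔ (Δ w (M ∖ i) (I - i) τ ⊎ cone (Δ w (M / i) (I - i)) i τ)))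
theorem3p2 n M mat E≡⊤ I w w-inj =
    (λ i i∈I loop τ → Δ-loop w mat i∈I loop)
  , (λ i _ coloop → Δ-coloop mat w w-inj (i∈E i) coloop)
  , (λ i max-i ¬loop _ → Δ-max mat w w-inj (i∈E i) max-i ¬loop)
  where
  i∈E : ∀ i → i ∈ E M
  i∈E i = subst (i ∈_) (sym E≡⊤) ∈⊤
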